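{- Let $2\le k\le n-2$, let $v_1,\dots,v_{\binom nk}$ be the vertices of $\Delta(k,n)$ in descending lexicographic order, and let $\kappa=\kappa_{k,n}$ be the lifting function with $\kappa(v_i)=1$ for $1\le i\le\binom{n-1}{k-1}-1$ and $\kappa(v_i)=0$ otherwise. The regular subdivision $\Delta(k,n)^\kappa$ comprises exactly $n$ maximal cells. Of these cells, $k$ are pyramids of lattice height one over $\Delta(k,n-1)$, and $n-k$ are pyramids over $\Delta(k-1,n-1)$.
   Context: The hypersimplex $\Delta(k,n)=\operatorname{conv}\{e_X : X\subseteq[n],\ |X|=k\}\subset\mathbb{R}^n$ with $e_X=\sum_{i\in X}e_i$; vertices are ordered in descending lexicographic order as 0/1-vectors (e.g., for $\Delta(2,4)$: $1100,1010,1001,0110,0101,0011$). A lifting function $\omega$ induces the regular subdivision $\Delta(k,n)^\omega$, whose cells are the projections (omitting the last coordinate) of the lower faces of $\operatorname{conv}\{(v,\omega(v))\}$, i.e., faces with an outer normal having negative last coordinate. A pyramid of lattice height one over a lattice polytope $Q$ is the convex hull of (a lattice-isomorphic copy of) $Q$ and an apex at lattice distance one from the affine hull of $Q$. -}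

module Defs where

open import Data.Nat using (ℕ; zero; suc; _∸_; _≤ᵇ_)
open import Data.Nat.Combinatorics using (_C_)
open import Data.Bool using (Bool; true; false; if_then_else_)
open import Data.Integer as ℤ using (ℤ; +_)
open import Data.Rational as ℚ using (ℚ; 0ℚ; 1ℚ)
open import Data.Fin using (Fin; toℕ)
open import Data.Fin.Subset using (Subset; _∈_; _⊆_)
open import Data.List as List using (List; []; _∷_; _++_; length)
open import Data.Vec as Vec using (Vec; []; _∷_; lookup; zipWith; foldr′)
open import Data.Product using (Σ; ∃; _×_)
open import Relation.Binary.PropositionalEquality using (_≡_; _≢_)

Pt : ℕ → Set
Pt d = Vec ℤ d

toℚ : ℤ → ℚ
toℚ z = z ℚ./ 1

dotℚ : ∀ {d} → Vec ℚ d → Pt d → ℚ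
dotℚ c x = foldr′ ℚ._+_ 0ℚ (zipWith (λ a b → a ℚ.* toℚ b) c x)

dotℤ : ∀ {d} → Vec ℤ d → Pt d → ℤ
dotℤ h x = foldr′ ℤ._+_ (+ 0) (zipWith ℤ._*_ h x)

sumℚ : ∀ {N} → Vec ℚ N → ℚ
sumℚ = foldr′ ℚ._+_ 0ℚ

InAff : ∀ {d N} → (Fin N → Pt d) → (Fin N → Set) → Pt d → Set
InAff {d} {N} P B y =
  Σ (Vec ℚ N) λ λs →
    (∀ i → (B i → Data.Empty.⊥) → lookup λs i ≡ 0ℚ)
    × sumℚ λs ≡ 1ℚ
    × (∀ (j : Fin d) →
         foldr′ ℚ._+_ 0ℚ (Vec.tabulate (λ i → lookup λs i ℚ.* toℚ (lookup (P i) j)))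
           ≡ toℚ (lookup y j))
  where import Data.Empty

affMap : ∀ {m n} → Vec (Vec ℤ m) n → Vec ℤ n → Pt m → Pt n
affMap M b x = zipWith (λ row bj → dotℤ row x ℤ.+ bj) M b

-- The hypersimplex Δ(k,n): vertices e_X, |X| = k, listed in DESCENDING
-- lexicographic order as 0/1-vectors (1 before 0 in each coordinate).

hyperVerts : ℕ → (n : ℕ) → List (Vec Bool n)
hyperVerts zero    zero    = [] ∷ []
hyperVerts (suc k) zero    = []
hyperVerts zero    (suc n) = List.map (false ∷_) (hyperVerts zero n)
hyperVerts (suc k) (suc n) =
  List.map (true ∷_) (hyperVerts k n) ++ List.map (false ∷_) (hyperVerts (suc k) n)

nV : ℕ → ℕ → ℕ
nV k n = length (hyperVerts k n)

b2z : Bool → ℤ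
b2z true  = + 1
b2z false = + 0

-- v_{i+1} (0-based index i) as a point of ℤ^n
vert : (k n : ℕ) → Fin (nV k n) → Pt n
vert k n i = Vec.map b2z (List.lookup (hyperVerts k n) i)

-- the lifting κ_{k,n}: κ(v_i) = 1 for 1 ≤ i ≤ C(n-1,k-1) - 1, else 0
-- (here i = toℕ idx + 1)
κ : (k n : ℕ) → Fin (nV k n) → ℚ
κ k n idx = if suc (toℕ idx) ≤ᵇ ((n ∸ 1) C (k ∸ 1) ∸ 1) then 1ℚ else 0ℚ

-- A cell of P^ω is recorded by the set S of indices
-- of the configuration points lying in the corresponding lower face of
-- conv{(P i, ω i)}; the cell is conv{P i | i ∈ S}.
-- Lower face with outer normal (c', -1): the points maximising c'·x - ω(x),
-- i.e. there is an affine function a(x) = c·x + c₀ with a ≤ ω on all points,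
-- with equality exactly on S.

IsCell : ∀ {d N} → (Fin N → Pt d) → (Fin N → ℚ) → Subset N → Set
IsCell {d} {N} P ω S =
  Σ (Vec ℚ d) λ c → Σ ℚ λ c₀ → ∀ (i : Fin N) →
    ((dotℚ c (P i) ℚ.+ c₀) ℚ.≤ ω i)
    × (dotℚ c (P i) ℚ.+ c₀ ≡ ω i → i ∈ S)
    × (i ∈ S → dotℚ c (P i) ℚ.+ c₀ ≡ ω i)

-- maximal cells (w.r.t. inclusion; the points are in convex position, so
-- inclusion of cells is inclusion of their vertex sets)
IsMaximalCell : ∀ {d N} → (Fin N → Pt d) → (Fin N → ℚ) → Subset N → Set
IsMaximalCell P ω S = IsCell P ω S × (∀ T → IsCell P ω T → S ⊆ T → T ≡ S)

-- Lattice isomorphism between a lattice polytope conv{Q q | all q} ⊂ ℝ^m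
-- and conv{P i | B i} ⊂ ℝ^n: an integral affine map f sending the vertex
-- set of the first onto the point set {P i | B i}, which restricts to a
-- bijection between the lattice points of the two affine hulls.

LatticeIsomorphic : ∀ {m M n N} → (Fin M → Pt m) → (Fin N → Pt n) → (Fin N → Set) → Set
LatticeIsomorphic {m} {M} {n} {N} Q P B =
  Σ (Vec (Vec ℤ m) n) λ A → Σ (Vec ℤ n) λ b →
    (∀ q → ∃ λ i → B i × affMap A b (Q q) ≡ P i)
    × (∀ i → B i → ∃ λ q → affMap A b (Q q) ≡ P i)
    × (∀ x x' → InAff Q (λ _ → Data.Unit.⊤) x → InAff Q (λ _ → Data.Unit.⊤) x' →
         affMap A b x ≡ affMap A b x' → x ≡ x')
    × (∀ y → InAff P B y → ∃ λ x → InAff Q (λ _ → Data.Unit.⊤) x × affMap A b x ≡ y)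
  where import Data.Unit

-- conv{P i | i ∈ S} is a pyramid of lattice height one over (a lattice-
-- isomorphic copy of) conv{Q q}: some a ∈ S is the apex, the remaining
-- points form a lattice-isomorphic copy of conv(Q), and the apex is at
-- lattice distance one from the affine hull of the base (there is an
-- integral affine functional vanishing on the base and equal to 1 at a).
IsPyramidHeightOneOver : ∀ {m M n N} → (Fin M → Pt m) → (Fin N → Pt n) → Subset N → Set
IsPyramidHeightOneOver {n = n} {N} Q P S =
  Σ (Fin N) λ a → a ∈ S
    × LatticeIsomorphic Q P (λ i → i ∈ S × i ≢ a)
    × (Σ (Vec ℤ n) λ h → Σ ℤ λ h₀ →
         (∀ i → i ∈ S → i ≢ a → dotℤ h (P i) ℤ.+ h₀ ≡ + 0)
         × dotℤ h (P a) ℤ.+ h₀ ≡ + 1)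

{-# OPTIONS --safe #-}
module Submission where

-- Counting coordinates from 0, κ = x₀ − [v = V] on the vertices, where V is the last vertex
-- with x₀ = 1 (those are listed first).  As x₀ is linear, Δ(k,n)^κ is the pulling of Δ(k,n)
-- at V: its maximal cells are conv(V ∪ F_i) for the n facets F_i = {x_i = 1 − V_i} missing V.
-- F_i is a copy of Δ(k, n−1) if V_i = 1 (k coordinates) and of Δ(k−1, n−1) if V_i = 0
-- (n − k coordinates), and x_i puts V at lattice distance one from it.  Every cell lies in
-- some conv(V ∪ F_i) by an exchange argument: a linear functional maximised on Δ(k,n), for
-- each coordinate j, by some vertex agreeing with V at j is also maximised at V, which cannot
-- happen on a lower face once V has been pulled down.  With 2 ≤ k ≤ n − 2 any two coordinates
-- of a vertex can be prescribed; this separates the n cells and makes each of them maximal.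

open import Defs
open import Data.Nat using (ℕ; zero; suc; _≤_; _<_; _+_; _∸_; z≤n; s≤s; _<ᵇ_)
import Data.Nat.Properties as ℕₚ
open import Data.Nat.Combinatorics using (_C_; nCk+nC[k+1]≡[n+1]C[k+1])
open import Data.Nat.GCD using () renaming (gcd-zeroʳ to ℕ-gcd-zeroʳ)
open import Data.Bool as Bool using (Bool; true; false; not; if_then_else_)
open import Data.Bool.Properties using (¬-not; not-¬; not-involutive; T-≡)
open import Data.Fin as Fin using (Fin; zero; suc; punchIn; punchOut; toℕ)
import Data.Fin.Properties as Finₚ
open import Data.Fin.Properties using (any?; ¬∀⟶∃¬)
open import Data.Fin.Permutation as Perm using (Permutation′; _⟨$⟩ʳ_; _⟨$⟩ˡ_)
open import Data.Fin.Subset using (Subset; _∈_; _∉_; _⊆_; ∣_∣)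
open import Data.Fin.Subset.Properties using (∣⊥∣≡0; ∣p∣≤n; _∈?_; _⊆?_; ⊆-antisym)
open import Data.Vec as Vec using (Vec; []; _∷_; lookup; insertAt; removeAt; replicate; _[_]≔_)
import Data.Vec.Properties as Vecₚ
open import Data.Vec.Relation.Binary.Pointwise.Extensional using (ext; Pointwise-≡⇒≡)
open import Data.List as List using (List; []; _∷_; _++_; length)
import Data.List.Properties as Listₚ
open import Data.List.Relation.Unary.All as All using (All; []; _∷_)
import Data.List.Relation.Unary.All.Properties as Allₚ
open import Data.List.Relation.Unary.AllPairs using ([]; _∷_)
open import Data.List.Relation.Unary.Any as Any using (here)
import Data.List.Relation.Unary.Any.Properties as Anyₚ
open import Data.List.Relation.Unary.Unique.Propositional using (Unique)
import Data.List.Relation.Unary.Unique.Propositional.Properties as Uniqueₚ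
open import Data.List.Membership.Propositional using () renaming (_∈_ to _∈ₗ_)
import Data.List.Membership.Propositional.Properties as ∈ₚ
open import Data.Integer as ℤ using (ℤ)
import Data.Integer.Properties as ℤₚ
open import Data.Rational as ℚ using (ℚ; 0ℚ; 1ℚ)
import Data.Rational.Properties as ℚₚ
open import Data.Rational.Solver using (module +-*-Solver)
open import Data.Product as Product using (Σ; ∃; _×_; _,_; proj₁; proj₂)
open import Data.Sum using (_⊎_; inj₁; inj₂; [_,_])
open import Data.Empty using (⊥-elim)
open import Data.Unit using (⊤; tt)
open import Function using (_∘_; id; const)
open import Function.Bundles using (Equivalence; _⇔_; mk⇔)
open import Relation.Unary using (Decidable)
open import Relation.Nullary using (¬_; yes; no; does; _×-dec_; _⊎-dec_; _→-dec_; ¬?)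
open import Relation.Nullary.Decidable using (dec-true; decidable-stable)
open import Relation.Binary.Definitions using (Tri; tri<; tri≈; tri>)
open import Relation.Binary.PropositionalEquality hiding ([_])
import Algebra.Bundles
open import Algebra.Properties.Semiring.Sum (Algebra.Bundles.CommutativeRing.semiring ℚₚ.+-*-commutativeRing)
  using (sum; sum-cong-≗; sum-remove; sum-replicate-zero; ∑-comm; *-distribʳ-sum)
open import Algebra.Definitions.RawMonoid ℚ.+-0-rawMonoid using () renaming (_×_ to _×ℚ_)
open +-*-Solver using (solve; _:+_; _:*_; _:-_; :-_; _:=_; con)

p+q-q≡p : ∀ p q → p ℚ.+ q ℚ.- q ≡ p
p+q-q≡p = solve 2 (λ p q → p :+ q :- q := p) refl

+-cancelʳ-≡ : ∀ {a b} c → a ℚ.+ c ≡ b ℚ.+ c → a ≡ b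
+-cancelʳ-≡ {a} {b} c e = trans (sym (p+q-q≡p a c)) (trans (cong (ℚ._- c) e) (p+q-q≡p b c))

+-cancelʳ-≤ : ∀ {a b} c → a ℚ.+ c ℚ.≤ b ℚ.+ c → a ℚ.≤ b
+-cancelʳ-≤ {a} {b} c le = subst₂ ℚ._≤_ (p+q-q≡p a c) (p+q-q≡p b c) (ℚₚ.+-monoˡ-≤ (ℚ.- c) le)

+-cancelˡ-≤ : ∀ {a b} c → c ℚ.+ a ℚ.≤ c ℚ.+ b → a ℚ.≤ b
+-cancelˡ-≤ {a} {b} c le = +-cancelʳ-≤ c (subst₂ ℚ._≤_ (ℚₚ.+-comm c a) (ℚₚ.+-comm c b) le)

+-cancelʳ-< : ∀ {a b} c → a ℚ.+ c ℚ.< b ℚ.+ c → a ℚ.< b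
+-cancelʳ-< {a} {b} c lt = subst₂ ℚ._<_ (p+q-q≡p a c) (p+q-q≡p b c) (ℚₚ.+-monoˡ-< (ℚ.- c) lt)

-1<0 : ℚ.- 1ℚ ℚ.< 0ℚ
-1<0 = ℚ.*<* ℤ.-<+

toℚ-injective : ∀ {a b} → toℚ a ≡ toℚ b → a ≡ b
toℚ-injective {a} {b} e = trans (sym (↥-toℚ a)) (trans (cong ℚ.↥_ e) (↥-toℚ b))
  where
  ↥-toℚ : ∀ z → ℚ.↥ (toℚ z) ≡ z
  ↥-toℚ z = trans (sym (ℤₚ.*-identityʳ (ℚ.↥ (toℚ z))))
            (trans (cong (λ g → ℚ.↥ (toℚ z) ℤ.* ℤ.+ g) (sym (ℕ-gcd-zeroʳ ℤ.∣ z ∣)))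
                   (ℚₚ.↥-/ z 1))

∣∷∣ : ∀ {n} b (v : Vec Bool n) → ∣ b ∷ v ∣ ≡ ∣ b ∷ [] ∣ + ∣ v ∣
∣∷∣ true  v = refl
∣∷∣ false v = refl

∣∷∣-cong : ∀ {n} b {v w : Vec Bool n} → ∣ v ∣ ≡ ∣ w ∣ → ∣ b ∷ v ∣ ≡ ∣ b ∷ w ∣
∣∷∣-cong true  = cong (1 +_)
∣∷∣-cong false = id

∣∷∷∣-swap : ∀ {n} x y (v : Vec Bool n) → ∣ x ∷ y ∷ v ∣ ≡ ∣ y ∷ x ∷ v ∣
∣∷∷∣-swap true  true  v = refl
∣∷∷∣-swap true  false v = refl
∣∷∷∣-swap false true  v = refl
∣∷∷∣-swap false false v = refl

∣insertAt∣ : ∀ {n} (v : Vec Bool n) i b → ∣ insertAt v i b ∣ ≡ ∣ b ∷ v ∣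
∣insertAt∣ v       zero    b = refl
∣insertAt∣ (x ∷ v) (suc i) b =
  trans (∣∷∣-cong x {insertAt v i b} {b ∷ v} (∣insertAt∣ v i b)) (∣∷∷∣-swap x b v)

∣[]≔false∣ : ∀ {n} (X : Vec Bool n) p → lookup X p ≡ true → suc ∣ X [ p ]≔ false ∣ ≡ ∣ X ∣
∣[]≔false∣ (true ∷ X)  zero    _ = refl
∣[]≔false∣ (false ∷ X) zero    ()
∣[]≔false∣ (true ∷ X)  (suc p) e = cong suc (∣[]≔false∣ X p e)
∣[]≔false∣ (false ∷ X) (suc p) e = ∣[]≔false∣ X p e

∣[]≔true∣ : ∀ {n} (X : Vec Bool n) q → lookup X q ≡ false → ∣ X [ q ]≔ true ∣ ≡ suc ∣ X ∣
∣[]≔true∣ (false ∷ X) zero    _ = refl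
∣[]≔true∣ (true ∷ X)  zero    ()
∣[]≔true∣ (true ∷ X)  (suc q) e = cong suc (∣[]≔true∣ X q e)
∣[]≔true∣ (false ∷ X) (suc q) e = ∣[]≔true∣ X q e

∣∣<⇒∃ : ∀ {n} (X Y : Vec Bool n) → ∣ X ∣ < ∣ Y ∣ →
        ∃ λ y → lookup Y y ≡ true × lookup X y ≡ false
∣∣<⇒∃ (false ∷ X) (true ∷ Y)  _        = zero , refl , refl
∣∣<⇒∃ (true ∷ X)  (true ∷ Y)  (s≤s lt) with y , p ← ∣∣<⇒∃ X Y lt = suc y , p
∣∣<⇒∃ (false ∷ X) (false ∷ Y) lt       with y , p ← ∣∣<⇒∃ X Y lt = suc y , p
∣∣<⇒∃ (true ∷ X)  (false ∷ Y) lt       with y , p ← ∣∣<⇒∃ X Y (ℕₚ.<⇒≤ lt) = suc y , p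

count-exchange : ∀ {n} (X Y : Vec Bool n) {z} → ∣ X ∣ ≡ ∣ Y ∣ →
                 lookup X z ≡ true → lookup Y z ≡ false →
                 ∃ λ y → lookup Y y ≡ true × lookup X y ≡ false
count-exchange X Y {z} ∣X∣≡∣Y∣ Xz Yz
  with y , Yy , X₋y ← ∣∣<⇒∃ (X [ z ]≔ false) Y
                       (ℕₚ.≤-reflexive (trans (∣[]≔false∣ X z Xz) ∣X∣≡∣Y∣)) =
  y , Yy , trans (sym (Vecₚ.lookup∘update′ y≢z X false)) X₋y
  where
  y≢z : y ≢ z
  y≢z refl with trans (sym Yz) Yy
  ... | ()

vertex-of-size : ∀ {m n} → m ≤ n → ∃ λ (v : Vec Bool n) → ∣ v ∣ ≡ m
vertex-of-size {zero}  {n}     _         = replicate n false , ∣⊥∣≡0 n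
vertex-of-size {suc m} {suc n} (s≤s m≤n) = Product.map (true ∷_) (cong suc) (vertex-of-size m≤n)

vertex-with-prefix : ∀ {m k} → 2 ≤ k → k ≤ m → (x y : Bool) →
                     ∃ λ (u : Vec Bool m) → ∣ x ∷ y ∷ u ∣ ≡ k
vertex-with-prefix _             k≤m false false = vertex-of-size k≤m
vertex-with-prefix (s≤s (s≤s _)) k≤m true  true
  with u , ∣u∣ ← vertex-of-size (ℕₚ.m+n≤o⇒n≤o 2 k≤m) = u , cong (2 +_) ∣u∣
vertex-with-prefix (s≤s (s≤s _)) k≤m true  false
  with u , ∣u∣ ← vertex-of-size (ℕₚ.m+n≤o⇒n≤o 1 k≤m) = u , cong (1 +_) ∣u∣
vertex-with-prefix (s≤s (s≤s _)) k≤m false true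
  with u , ∣u∣ ← vertex-of-size (ℕₚ.m+n≤o⇒n≤o 1 k≤m) = u , cong (1 +_) ∣u∣

vertex-with-values : ∀ {n k} (i j : Fin n) → i ≢ j → 2 ≤ k → k + 2 ≤ n → (x y : Bool) →
                     ∃ λ w → ∣ w ∣ ≡ k × lookup w i ≡ x × lookup w j ≡ y
vertex-with-values {suc zero}    zero zero i≢j _ _ _ _ = ⊥-elim (i≢j refl)
vertex-with-values {suc (suc m)} {k} i j i≢j 2≤k k+2≤n x y = w , ∣w∣ , at-i , at-j
  where
  open ≡-Reasoning
  j′ : Fin (suc m)
  j′ = punchOut i≢j
  k≤m : k ≤ m
  k≤m = ℕₚ.+-cancelʳ-≤ 2 k m (subst (k + 2 ≤_) (ℕₚ.+-comm 2 m) k+2≤n)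
  u : Vec Bool m
  u = proj₁ (vertex-with-prefix 2≤k k≤m x y)
  w : Vec Bool (suc (suc m))
  w = insertAt (insertAt u j′ y) i x
  ∣w∣ : ∣ w ∣ ≡ k
  ∣w∣ = begin
    ∣ w ∣                      ≡⟨ ∣insertAt∣ (insertAt u j′ y) i x ⟩
    ∣ x ∷ insertAt u j′ y ∣    ≡⟨ ∣∷∣-cong x {insertAt u j′ y} {y ∷ u} (∣insertAt∣ u j′ y) ⟩
    ∣ x ∷ y ∷ u ∣              ≡⟨ proj₂ (vertex-with-prefix 2≤k k≤m x y) ⟩
    k                          ∎
  at-i : lookup w i ≡ x
  at-i = Vecₚ.insertAt-lookup (insertAt u j′ y) i x
  at-j : lookup w j ≡ y
  at-j = begin
    lookup w j                    ≡⟨ cong (lookup w) (Finₚ.punchIn-punchOut i≢j) ⟨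
    lookup w (punchIn i j′)       ≡⟨ Vecₚ.insertAt-punchIn (insertAt u j′ y) i x j′ ⟩
    lookup (insertAt u j′ y) j′   ≡⟨ Vecₚ.insertAt-lookup u j′ y ⟩
    y                             ∎

⟦_⟧ : ∀ {n} → Vec Bool n → Pt n
⟦_⟧ = Vec.map b2z

bit : Bool → ℚ
bit b = toℚ (b2z b)

dot-zeros : ∀ {n} (x : Pt n) → dotℚ (replicate n 0ℚ) x ≡ 0ℚ
dot-zeros []      = refl
dot-zeros (t ∷ x) = trans (cong₂ ℚ._+_ (ℚₚ.*-zeroˡ (toℚ t)) (dot-zeros x)) (ℚₚ.+-identityˡ 0ℚ)

dot-unit : ∀ {n} (i : Fin n) s (v : Vec Bool n) →
           dotℚ (replicate n 0ℚ [ i ]≔ s) ⟦ v ⟧ ≡ s ℚ.* bit (lookup v i)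
dot-unit zero    s (b ∷ v) =
  trans (cong (s ℚ.* bit b ℚ.+_) (dot-zeros ⟦ v ⟧)) (ℚₚ.+-identityʳ (s ℚ.* bit b))
dot-unit (suc i) s (b ∷ v) = trans (cong₂ ℚ._+_ (ℚₚ.*-zeroˡ (bit b)) (dot-unit i s v)) (ℚₚ.+-identityˡ _)

dot-zipWith-+ : ∀ {d} (c ℓ : Vec ℚ d) (x : Pt d) →
                dotℚ (Vec.zipWith ℚ._+_ c ℓ) x ≡ dotℚ c x ℚ.+ dotℚ ℓ x
dot-zipWith-+ []       []       []      = sym (ℚₚ.+-identityˡ 0ℚ)
dot-zipWith-+ (c ∷ cs) (l ∷ ls) (t ∷ x) = trans (cong ((c ℚ.+ l) ℚ.* toℚ t ℚ.+_) (dot-zipWith-+ cs ls x))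
  (solve 5 (λ c l t a b → (c :+ l) :* t :+ (a :+ b) := (c :* t :+ a) :+ (l :* t :+ b)) refl
           c l (toℚ t) (dotℚ cs x) (dotℚ ls x))

dot-neg : ∀ {d} (ℓ : Vec ℚ d) (x : Pt d) → dotℚ (Vec.map ℚ.-_ ℓ) x ≡ ℚ.- dotℚ ℓ x
dot-neg []       []      = refl
dot-neg (l ∷ ls) (t ∷ x) = trans (cong (ℚ.- l ℚ.* toℚ t ℚ.+_) (dot-neg ls x))
  (solve 3 (λ l t a → (:- l) :* t :+ (:- a) := :- (l :* t :+ a)) refl l (toℚ t) (dotℚ ls x))

dot-[]≔false : ∀ {n} (c : Vec ℚ n) (X : Vec Bool n) p → lookup X p ≡ true →
               dotℚ c ⟦ X [ p ]≔ false ⟧ ℚ.+ lookup c p ≡ dotℚ c ⟦ X ⟧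
dot-[]≔false (c ∷ cs) (true ∷ X)  zero    _ =
  solve 2 (λ c d → c :* con 0ℚ :+ d :+ c := c :* con 1ℚ :+ d) refl c (dotℚ cs ⟦ X ⟧)
dot-[]≔false (c ∷ cs) (false ∷ X) zero    ()
dot-[]≔false (c ∷ cs) (x ∷ X)     (suc p) e =
  trans (ℚₚ.+-assoc (c ℚ.* bit x) (dotℚ cs ⟦ X [ p ]≔ false ⟧) (lookup cs p))
        (cong (c ℚ.* bit x ℚ.+_) (dot-[]≔false cs X p e))

dot-[]≔true : ∀ {n} (c : Vec ℚ n) (X : Vec Bool n) q → lookup X q ≡ false →
              dotℚ c ⟦ X [ q ]≔ true ⟧ ≡ dotℚ c ⟦ X ⟧ ℚ.+ lookup c q
dot-[]≔true (c ∷ cs) (false ∷ X) zero    _ =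
  solve 2 (λ c d → c :* con 1ℚ :+ d := c :* con 0ℚ :+ d :+ c) refl c (dotℚ cs ⟦ X ⟧)
dot-[]≔true (c ∷ cs) (true ∷ X)  zero    ()
dot-[]≔true (c ∷ cs) (x ∷ X)     (suc q) e =
  trans (cong (c ℚ.* bit x ℚ.+_) (dot-[]≔true cs X q e))
        (sym (ℚₚ.+-assoc (c ℚ.* bit x) (dotℚ cs ⟦ X ⟧) (lookup cs q)))

dot-replicate : ∀ {n} t (X : Vec Bool n) → dotℚ (replicate n t) ⟦ X ⟧ ≡ ∣ X ∣ ×ℚ t
dot-replicate t []          = refl
dot-replicate t (true ∷ X)  = cong₂ ℚ._+_ (ℚₚ.*-identityʳ t) (dot-replicate t X)
dot-replicate t (false ∷ X) =
  trans (cong (ℚ._+ dotℚ (replicate _ t) ⟦ X ⟧) (ℚₚ.*-zeroʳ t))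
        (trans (ℚₚ.+-identityˡ _) (dot-replicate t X))

dot-constant-on-difference : ∀ {n} (c : Vec ℚ n) t (X Y : Vec Bool n) →
  (∀ s → lookup X s ≢ lookup Y s → lookup c s ≡ t) →
  dotℚ c ⟦ X ⟧ ℚ.+ dotℚ (replicate n t) ⟦ Y ⟧ ≡ dotℚ c ⟦ Y ⟧ ℚ.+ dotℚ (replicate n t) ⟦ X ⟧
dot-constant-on-difference []       t []      []      _ = refl
dot-constant-on-difference (c ∷ cs) t (x ∷ X) (y ∷ Y) c≡t = begin
  (c ℚ.* bit x ℚ.+ cX) ℚ.+ (t ℚ.* bit y ℚ.+ tY)
    ≡⟨ interchange (c ℚ.* bit x) cX (t ℚ.* bit y) tY ⟩
  (c ℚ.* bit x ℚ.+ t ℚ.* bit y) ℚ.+ (cX ℚ.+ tY)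
    ≡⟨ cong₂ ℚ._+_ heads (dot-constant-on-difference cs t X Y (c≡t ∘ suc)) ⟩
  (c ℚ.* bit y ℚ.+ t ℚ.* bit x) ℚ.+ (cY ℚ.+ tX)
    ≡⟨ interchange (c ℚ.* bit y) (t ℚ.* bit x) cY tX ⟩
  (c ℚ.* bit y ℚ.+ cY) ℚ.+ (t ℚ.* bit x ℚ.+ tX)  ∎
  where
  open ≡-Reasoning
  cX cY tX tY : ℚ
  cX = dotℚ cs ⟦ X ⟧
  cY = dotℚ cs ⟦ Y ⟧
  tX = dotℚ (replicate _ t) ⟦ X ⟧
  tY = dotℚ (replicate _ t) ⟦ Y ⟧
  interchange : ∀ a b c d → (a ℚ.+ b) ℚ.+ (c ℚ.+ d) ≡ (a ℚ.+ c) ℚ.+ (b ℚ.+ d)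
  interchange = solve 4 (λ a b c d → (a :+ b) :+ (c :+ d) := (a :+ c) :+ (b :+ d)) refl
  heads : c ℚ.* bit x ℚ.+ t ℚ.* bit y ≡ c ℚ.* bit y ℚ.+ t ℚ.* bit x
  heads with x Bool.≟ y
  ... | yes refl = refl
  ... | no x≢y rewrite c≡t zero x≢y = ℚₚ.+-comm (t ℚ.* bit x) (t ℚ.* bit y)

module _ {n} (c : Vec ℚ n) (X Y : Vec Bool n) (∣X∣≡∣Y∣ : ∣ X ∣ ≡ ∣ Y ∣)
         (balanced : ∀ p q → lookup X p ≡ true → lookup Y p ≡ false →
                             lookup Y q ≡ true → lookup X q ≡ false → lookup c p ≡ lookup c q) where

  constant-on-difference : ∃ λ t → ∀ s → lookup X s ≢ lookup Y s → lookup c s ≡ t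
  constant-on-difference with any? (λ p → (lookup X p Bool.≟ true) ×-dec (lookup Y p Bool.≟ false))
  ... | yes (p , Xp , Yp) = lookup c p , weight
    where
    weight : ∀ s → lookup X s ≢ lookup Y s → lookup c s ≡ lookup c p
    weight s Xs≢Ys with lookup X s in Xs | lookup Y s in Ys
    ... | true  | true  = ⊥-elim (Xs≢Ys refl)
    ... | false | false = ⊥-elim (Xs≢Ys refl)
    ... | false | true  = sym (balanced p s Xp Yp Ys Xs)
    ... | true  | false with q , Yq , Xq ← count-exchange X Y ∣X∣≡∣Y∣ Xs Ys =
      trans (balanced s q Xs Ys Yq Xq) (sym (balanced p q Xp Yp Yq Xq))
  ... | no ∄p = 0ℚ , no-difference
    where
    no-difference : ∀ s → lookup X s ≢ lookup Y s → lookup c s ≡ 0ℚ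
    no-difference s Xs≢Ys with lookup X s in Xs | lookup Y s in Ys
    ... | true  | true  = ⊥-elim (Xs≢Ys refl)
    ... | false | false = ⊥-elim (Xs≢Ys refl)
    ... | true  | false = ⊥-elim (∄p (s , Xs , Ys))
    ... | false | true with q , Xq , Yq ← count-exchange Y X (sym ∣X∣≡∣Y∣) Ys Xs = ⊥-elim (∄p (q , Xq , Yq))

  -- With c ≡ t on the symmetric difference, c·X − c·Y = t (∣X∣ − ∣Y∣) = 0.
  dot-≡-balanced : dotℚ c ⟦ X ⟧ ≡ dotℚ c ⟦ Y ⟧
  dot-≡-balanced = +-cancelʳ-≡ (dotℚ (replicate n t) ⟦ X ⟧) (begin
    dotℚ c ⟦ X ⟧ ℚ.+ dotℚ (replicate n t) ⟦ X ⟧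
      ≡⟨ cong (dotℚ c ⟦ X ⟧ ℚ.+_) same-count ⟩
    dotℚ c ⟦ X ⟧ ℚ.+ dotℚ (replicate n t) ⟦ Y ⟧
      ≡⟨ dot-constant-on-difference c t X Y (proj₂ constant-on-difference) ⟩
    dotℚ c ⟦ Y ⟧ ℚ.+ dotℚ (replicate n t) ⟦ X ⟧  ∎)
    where
    open ≡-Reasoning
    t : ℚ
    t = proj₁ constant-on-difference
    same-count : dotℚ (replicate n t) ⟦ X ⟧ ≡ dotℚ (replicate n t) ⟦ Y ⟧
    same-count = trans (dot-replicate t X) (trans (cong (_×ℚ t) ∣X∣≡∣Y∣) (sym (dot-replicate t Y)))

-- Vertices of Δ(k,n) maximising a linear functional

IsMaximizer : ∀ {n} → Vec ℚ n → ℕ → Vec Bool n → Set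
IsMaximizer c k Y = ∣ Y ∣ ≡ k × (∀ v → ∣ v ∣ ≡ k → dotℚ c ⟦ v ⟧ ℚ.≤ dotℚ c ⟦ Y ⟧)

module _ {n} {c : Vec ℚ n} {k : ℕ} where

  exchange-≤ : ∀ {Y p q} → IsMaximizer c k Y → lookup Y p ≡ true → lookup Y q ≡ false →
               lookup c q ℚ.≤ lookup c p
  exchange-≤ {Y} {p} {q} (∣Y∣ , max) Yp Yq = +-cancelˡ-≤ (dotℚ c ⟦ Y₋ ⟧) (begin
    dotℚ c ⟦ Y₋ ⟧ ℚ.+ lookup c q  ≡⟨ dot-[]≔true c Y₋ q Y₋q ⟨
    dotℚ c ⟦ Y₊ ⟧                 ≤⟨ max Y₊ ∣Y₊∣ ⟩
    dotℚ c ⟦ Y ⟧                  ≡⟨ dot-[]≔false c Y p Yp ⟨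
    dotℚ c ⟦ Y₋ ⟧ ℚ.+ lookup c p  ∎)
    where
    open ℚₚ.≤-Reasoning
    Y₋ Y₊ : Vec Bool n
    Y₋ = Y [ p ]≔ false
    Y₊ = Y₋ [ q ]≔ true
    q≢p : q ≢ p
    q≢p refl with trans (sym Yp) Yq
    ... | ()
    Y₋q : lookup Y₋ q ≡ false
    Y₋q = trans (Vecₚ.lookup∘update′ q≢p Y false) Yq
    ∣Y₊∣ : ∣ Y₊ ∣ ≡ k
    ∣Y₊∣ = trans (∣[]≔true∣ Y₋ q Y₋q) (trans (∣[]≔false∣ Y p Yp) ∣Y∣)

  exchange-≤₂ : ∀ {Y Z p q} → IsMaximizer c k Y → IsMaximizer c k Z →
                lookup Y p ≡ true → lookup Z q ≡ false → lookup c q ℚ.≤ lookup c p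
  exchange-≤₂ {Y} {Z} {p} {q} Y-max Z-max Yp Zq with lookup Y q in Yq
  ... | false = exchange-≤ Y-max Yp Yq
  ... | true with r , Zr , Yr ← count-exchange Y Z (trans (proj₁ Y-max) (sym (proj₁ Z-max))) Yq Zq =
    ℚₚ.≤-trans (exchange-≤ Z-max Zr Zq) (exchange-≤ Y-max Yp Yr)

  agreeing-maximizer : ∀ V → ∣ V ∣ ≡ k →
                       (∀ j → ∃ λ Y → IsMaximizer c k Y × lookup Y j ≡ lookup V j) →
                       IsMaximizer c k V
  agreeing-maximizer []          ∣V∣ _     = ∣V∣ , λ { [] _ → ℚₚ.≤-refl }
  agreeing-maximizer V@(_ ∷ _) ∣V∣ agree =
    ∣V∣ , λ v ∣v∣ → subst (dotℚ c ⟦ v ⟧ ℚ.≤_) Z≡V (proj₂ Z-max v ∣v∣)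
    where
    Z : Vec Bool n
    Z = proj₁ (agree zero)
    Z-max : IsMaximizer c k Z
    Z-max = proj₁ (proj₂ (agree zero))
    Z≡V : dotℚ c ⟦ Z ⟧ ≡ dotℚ c ⟦ V ⟧
    Z≡V = dot-≡-balanced c Z V (trans (proj₁ Z-max) (sym ∣V∣)) λ p q Zp Vp Vq Zq →
      let _ , Yp-max , Yp-agrees = agree p
          _ , Yq-max , Yq-agrees = agree q
      in ℚₚ.≤-antisym (exchange-≤₂ Yq-max Yp-max (trans Yq-agrees Vq) (trans Yp-agrees Vp))
                      (exchange-≤ Z-max Zp Zq)

vertexVec : (k n : ℕ) → Fin (nV k n) → Vec Bool n
vertexVec k n = List.lookup (hyperVerts k n)

hyperVerts-count : ∀ k n → All (λ v → ∣ v ∣ ≡ k) (hyperVerts k n)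
hyperVerts-count zero    zero    = refl ∷ []
hyperVerts-count (suc k) zero    = []
hyperVerts-count zero    (suc n) = Allₚ.map⁺ (hyperVerts-count zero n)
hyperVerts-count (suc k) (suc n) =
  Allₚ.++⁺ (Allₚ.map⁺ (All.map (cong (1 +_)) (hyperVerts-count k n))) (Allₚ.map⁺ (hyperVerts-count (suc k) n))

∈-hyperVerts : ∀ {n} k (v : Vec Bool n) → ∣ v ∣ ≡ k → v ∈ₗ hyperVerts k n
∈-hyperVerts zero    []          refl = here refl
∈-hyperVerts zero    (false ∷ v) e    = ∈ₚ.∈-map⁺ (false ∷_) (∈-hyperVerts zero v e)
∈-hyperVerts (suc k) (false ∷ v) e    =
  ∈ₚ.∈-++⁺ʳ (List.map (true ∷_) (hyperVerts k _)) (∈ₚ.∈-map⁺ (false ∷_) (∈-hyperVerts (suc k) v e))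
∈-hyperVerts (suc k) (true ∷ v)  e    =
  ∈ₚ.∈-++⁺ˡ (∈ₚ.∈-map⁺ (true ∷_) (∈-hyperVerts k v (ℕₚ.suc-injective e)))

hyperVerts-unique : ∀ k n → Unique (hyperVerts k n)
hyperVerts-unique zero    zero    = [] ∷ []
hyperVerts-unique (suc k) zero    = []
hyperVerts-unique zero    (suc n) = Uniqueₚ.map⁺ Vecₚ.∷-injectiveʳ (hyperVerts-unique zero n)
hyperVerts-unique (suc k) (suc n) =
  Uniqueₚ.++⁺ (Uniqueₚ.map⁺ Vecₚ.∷-injectiveʳ (hyperVerts-unique k n))
              (Uniqueₚ.map⁺ Vecₚ.∷-injectiveʳ (hyperVerts-unique (suc k) n)) first-coordinates-differ
  where
  first-coordinates-differ : ∀ {v} → ¬ (v ∈ₗ List.map (true ∷_) (hyperVerts k n)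
                                       × v ∈ₗ List.map (false ∷_) (hyperVerts (suc k) n))
  first-coordinates-differ (v∈₁ , v∈₂) with ∈ₚ.∈-map⁻ (true ∷_) v∈₁ | ∈ₚ.∈-map⁻ (false ∷_) v∈₂
  ... | _ , _ , refl | _ , _ , ()

lookup-injective : ∀ {A : Set} {xs : List A} → Unique xs →
                   ∀ i j → List.lookup xs i ≡ List.lookup xs j → i ≡ j
lookup-injective (_ ∷ _)      zero    zero    _ = refl
lookup-injective (x∉xs ∷ _)   zero    (suc j) e = ⊥-elim (All.lookup x∉xs (∈ₚ.∈-lookup j) e)
lookup-injective (x∉xs ∷ _)   (suc i) zero    e = ⊥-elim (All.lookup x∉xs (∈ₚ.∈-lookup i) (sym e))
lookup-injective (_ ∷ unique) (suc i) (suc j) e = cong suc (lookup-injective unique i j e)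

∣vertexVec∣ : ∀ k n i → ∣ vertexVec k n i ∣ ≡ k
∣vertexVec∣ k n i = All.lookup (hyperVerts-count k n) (∈ₚ.∈-lookup i)

vertexVec-injective : ∀ k n i j → vertexVec k n i ≡ vertexVec k n j → i ≡ j
vertexVec-injective k n = lookup-injective (hyperVerts-unique k n)

vertexVec-surjective : ∀ {k n} (v : Vec Bool n) → ∣ v ∣ ≡ k → ∃ λ i → vertexVec k n i ≡ v
vertexVec-surjective {k} v ∣v∣ = Any.index v∈ , sym (Anyₚ.lookup-index v∈)
  where
  v∈ : v ∈ₗ hyperVerts k _
  v∈ = ∈-hyperVerts k v ∣v∣

nV-suc : ∀ k n → nV (suc k) (suc n) ≡ nV k n + nV (suc k) n
nV-suc k n = trans (Listₚ.length-++ (List.map (true ∷_) (hyperVerts k n)))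
  (cong₂ _+_ (Listₚ.length-map (true ∷_) (hyperVerts k n)) (Listₚ.length-map (false ∷_) (hyperVerts (suc k) n)))

nV≡C : ∀ k n → nV k n ≡ n C k
nV≡C zero    zero    = refl
nV≡C (suc k) zero    = refl
nV≡C zero    (suc n) = trans (Listₚ.length-map (false ∷_) (hyperVerts zero n)) (trans (nV≡C zero n) (nC0≡1 n))
  where
  nC0≡1 : ∀ n → n C 0 ≡ 1
  nC0≡1 zero    = refl
  nC0≡1 (suc n) = refl
nV≡C (suc k) (suc n) = begin
  nV (suc k) (suc n)     ≡⟨ nV-suc k n ⟩
  nV k n + nV (suc k) n  ≡⟨ cong₂ _+_ (nV≡C k n) (nV≡C (suc k) n) ⟩
  n C k + n C suc k      ≡⟨ nCk+nC[k+1]≡[n+1]C[k+1] n k ⟩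
  suc n C suc k          ∎
  where open ≡-Reasoning

vertexVec-first : ∀ k n i → lookup (vertexVec (suc k) (suc n) i) zero ≡ (toℕ i <ᵇ nV k n)
vertexVec-first k n = first-of-++ (hyperVerts k n) (hyperVerts (suc k) n)
  where
  first-of-map-false : ∀ (ys : List (Vec Bool n)) i → lookup (List.lookup (List.map (false ∷_) ys) i) zero ≡ false
  first-of-map-false (_ ∷ _)  zero    = refl
  first-of-map-false (_ ∷ ys) (suc i) = first-of-map-false ys i
  first-of-++ : ∀ xs ys i → lookup (List.lookup (List.map (true ∷_) xs ++ List.map (false ∷_) ys) i) zero
                            ≡ (toℕ i <ᵇ length xs)
  first-of-++ []       ys i       = first-of-map-false ys i
  first-of-++ (_ ∷ _)  ys zero    = refl
  first-of-++ (_ ∷ xs) ys (suc i) = first-of-++ xs ys i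

isCell-intro : ∀ {d N} {P : Fin N → Pt d} {ω : Fin N → ℚ} {S : Subset N} (c : Vec ℚ d) (c₀ : ℚ) →
  (∀ i → (dotℚ c (P i) ℚ.+ c₀ ≡ ω i × i ∈ S) ⊎ (dotℚ c (P i) ℚ.+ c₀ ℚ.< ω i × i ∉ S)) →
  IsCell P ω S
isCell-intro c c₀ position = c , c₀ , λ i → on-or-below (position i)
  where
  on-or-below : ∀ {a w} {i∈S : Set} → (a ≡ w × i∈S) ⊎ (a ℚ.< w × ¬ i∈S) →
                a ℚ.≤ w × (a ≡ w → i∈S) × (i∈S → a ≡ w)
  on-or-below (inj₁ (a≡w , i∈S)) = ℚₚ.≤-reflexive a≡w , const i∈S , const a≡w
  on-or-below (inj₂ (a<w , i∉S)) = ℚₚ.<⇒≤ a<w , ⊥-elim ∘ ℚₚ.<⇒≢ a<w , ⊥-elim ∘ i∉S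

module _ {d N} {P : Fin N → Pt d} where

  IsCell-shift : ∀ {ω₁ ω₂ S} (ℓ : Vec ℚ d) → (∀ i → ω₂ i ≡ ω₁ i ℚ.+ dotℚ ℓ (P i)) →
                 IsCell P ω₁ S → IsCell P ω₂ S
  IsCell-shift ℓ ω₂≡ (c , c₀ , H) = Vec.zipWith ℚ._+_ c ℓ , c₀ , λ i →
    let below , on⇒∈ , ∈⇒on = H i
    in subst₂ ℚ._≤_ (sym (shifted i)) (sym (ω₂≡ i)) (ℚₚ.+-monoˡ-≤ (dotℚ ℓ (P i)) below)
     , (λ on → on⇒∈ (+-cancelʳ-≡ (dotℚ ℓ (P i)) (trans (sym (shifted i)) (trans on (ω₂≡ i)))))
     , (λ i∈S → trans (shifted i) (trans (cong (ℚ._+ dotℚ ℓ (P i)) (∈⇒on i∈S)) (sym (ω₂≡ i))))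
    where
    shifted : ∀ i → dotℚ (Vec.zipWith ℚ._+_ c ℓ) (P i) ℚ.+ c₀
                    ≡ (dotℚ c (P i) ℚ.+ c₀) ℚ.+ dotℚ ℓ (P i)
    shifted i = trans (cong (ℚ._+ c₀) (dot-zipWith-+ c ℓ (P i)))
      (solve 3 (λ a b c₀ → (a :+ b) :+ c₀ := (a :+ c₀) :+ b) refl (dotℚ c (P i)) (dotℚ ℓ (P i)) c₀)

  IsMaximalCell-shift : ∀ {ω₁ ω₂ S} (ℓ : Vec ℚ d) → (∀ i → ω₂ i ≡ ω₁ i ℚ.+ dotℚ ℓ (P i)) →
                        IsMaximalCell P ω₁ S ⇔ IsMaximalCell P ω₂ S
  IsMaximalCell-shift {ω₁} {ω₂} ℓ ω₂≡ = mk⇔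
    (λ (S-cell , S-max) → IsCell-shift ℓ ω₂≡ S-cell ,
                          λ T T-cell S⊆T → S-max T (IsCell-shift −ℓ ω₁≡ T-cell) S⊆T)
    (λ (S-cell , S-max) → IsCell-shift −ℓ ω₁≡ S-cell ,
                          λ T T-cell S⊆T → S-max T (IsCell-shift ℓ ω₂≡ T-cell) S⊆T)
    where
    −ℓ : Vec ℚ d
    −ℓ = Vec.map ℚ.-_ ℓ
    ω₁≡ : ∀ i → ω₁ i ≡ ω₂ i ℚ.+ dotℚ −ℓ (P i)
    ω₁≡ i = begin
      ω₁ i                                      ≡⟨ p+q-q≡p (ω₁ i) (dotℚ ℓ (P i)) ⟨
      (ω₁ i ℚ.+ dotℚ ℓ (P i)) ℚ.- dotℚ ℓ (P i)  ≡⟨ cong₂ ℚ._+_ (sym (ω₂≡ i)) (sym (dot-neg ℓ (P i))) ⟩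
      ω₂ i ℚ.+ dotℚ −ℓ (P i)                    ∎
      where open ≡-Reasoning

foldr-tabulate : ∀ {m} (f : Fin m → ℚ) → Vec.foldr′ ℚ._+_ 0ℚ (Vec.tabulate f) ≡ sum f
foldr-tabulate {zero}  f = refl
foldr-tabulate {suc m} f = cong (f zero ℚ.+_) (foldr-tabulate (f ∘ suc))

sumℚ-lookup : ∀ {m} (xs : Vec ℚ m) → sumℚ xs ≡ sum (lookup xs)
sumℚ-lookup []       = refl
sumℚ-lookup (x ∷ xs) = cong (x ℚ.+_) (sumℚ-lookup xs)

sum-single : ∀ {m} (f : Fin m → ℚ) i → (∀ j → j ≢ i → f j ≡ 0ℚ) → sum f ≡ f i
sum-single {suc m} f i off-i = begin
  sum f                         ≡⟨ sum-remove f ⟩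
  f i ℚ.+ sum (f ∘ punchIn i)   ≡⟨ cong (f i ℚ.+_) (sum-cong-≗ (λ j → off-i _ (Finₚ.punchInᵢ≢i i j))) ⟩
  f i ℚ.+ sum {m} (const 0ℚ)    ≡⟨ cong (f i ℚ.+_) (sum-replicate-zero m) ⟩
  f i ℚ.+ 0ℚ                    ≡⟨ ℚₚ.+-identityʳ (f i) ⟩
  f i                           ∎
  where open ≡-Reasoning

sum-reindex : ∀ {m n} {B : Fin n → Set} → Decidable B →
              (φ : Fin m → Fin n) → (∀ {i j} → φ i ≡ φ j → i ≡ j) → (∀ j → B j → ∃ λ i → φ i ≡ j) →
              (g : Fin n → ℚ) → (∀ j → ¬ B j → g j ≡ 0ℚ) → sum (g ∘ φ) ≡ sum g
sum-reindex {m} {n} B? φ φ-injective φ-onto g off-B = begin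
  sum (g ∘ φ)                      ≡⟨ sum-cong-≗ row ⟨
  sum (λ i → sum (h i))            ≡⟨ ∑-comm h ⟩
  sum (λ j → sum (λ i → h i j))    ≡⟨ sum-cong-≗ column ⟩
  sum g                            ∎
  where
  open ≡-Reasoning
  h : Fin m → Fin n → ℚ
  h i j = if does (φ i Fin.≟ j) then g j else 0ℚ
  h-on : ∀ {i j} → φ i ≡ j → h i j ≡ g j
  h-on {i} {j} φi≡j with φ i Fin.≟ j
  ... | yes _    = refl
  ... | no φi≢j  = ⊥-elim (φi≢j φi≡j)
  h-off : ∀ {i j} → φ i ≢ j → h i j ≡ 0ℚ
  h-off {i} {j} φi≢j with φ i Fin.≟ j
  ... | yes φi≡j = ⊥-elim (φi≢j φi≡j)
  ... | no _     = refl
  row : ∀ i → sum (h i) ≡ g (φ i)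
  row i = trans (sum-single (h i) (φ i) (λ j j≢φi → h-off (j≢φi ∘ sym))) (h-on refl)
  column : ∀ j → sum (λ i → h i j) ≡ g j
  column j with B? j
  ... | yes Bj with i , refl ← φ-onto j Bj =
    trans (sum-single (λ i′ → h i′ (φ i)) i (λ i′ i′≢i → h-off (i′≢i ∘ φ-injective))) (h-on refl)
  ... | no ¬Bj = trans (sum-cong-≗ h≡0) (trans (sum-replicate-zero m) (sym (off-B j ¬Bj)))
    where
    h≡0 : ∀ i → h i j ≡ 0ℚ
    h≡0 i with φ i Fin.≟ j
    ... | yes _ = off-B j ¬Bj
    ... | no _  = refl

module _ {d N} {P : Fin N → Pt d} where

  InAff-mono : ∀ {B B′ : Fin N → Set} {y} → (∀ i → B i → B′ i) → InAff P B y → InAff P B′ y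
  InAff-mono B⇒B′ (λs , support , total , coords) =
    λs , (λ i ¬B′ → support i (¬B′ ∘ B⇒B′ i)) , total , coords

  InAff-coordinate : ∀ {B : Fin N → Set} → Decidable B → ∀ {t z y} →
                     (∀ i → B i → lookup (P i) t ≡ z) → InAff P B y → lookup y t ≡ z
  InAff-coordinate {B} B? {t} {z} {y} on-hyperplane (λs , support , total , coords) = toℚ-injective (begin
    toℚ (lookup y t)                             ≡⟨ coords t ⟨
    Vec.foldr′ ℚ._+_ 0ℚ (Vec.tabulate weighted)  ≡⟨ foldr-tabulate weighted ⟩
    sum weighted                                 ≡⟨ sum-cong-≗ pointwise ⟩
    sum (λ i → lookup λs i ℚ.* toℚ z)            ≡⟨ *-distribʳ-sum (toℚ z) (lookup λs) ⟨
    sum (lookup λs) ℚ.* toℚ z                    ≡⟨ cong (ℚ._* toℚ z) (trans (sym (sumℚ-lookup λs)) total) ⟩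
    1ℚ ℚ.* toℚ z                                 ≡⟨ ℚₚ.*-identityˡ (toℚ z) ⟩
    toℚ z                                        ∎)
    where
    open ≡-Reasoning
    weighted : Fin N → ℚ
    weighted i = lookup λs i ℚ.* toℚ (lookup (P i) t)
    pointwise : ∀ i → weighted i ≡ lookup λs i ℚ.* toℚ z
    pointwise i with B? i
    ... | yes Bi = cong (λ x → lookup λs i ℚ.* toℚ x) (on-hyperplane i Bi)
    ... | no ¬Bi = trans (vanishes (toℚ (lookup (P i) t))) (sym (vanishes (toℚ z)))
      where
      vanishes : ∀ x → lookup λs i ℚ.* x ≡ 0ℚ
      vanishes x = trans (cong (ℚ._* x) (support i ¬Bi)) (ℚₚ.*-zeroˡ x)

  InAff-pullback : ∀ {m M} {Q : Fin M → Pt m} {B : Fin N → Set} → Decidable B →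
    (φ : Fin M → Fin N) → (∀ {i j} → φ i ≡ φ j → i ≡ j) → (∀ j → B j → ∃ λ i → φ i ≡ j) →
    (π : Fin m → Fin d) → (∀ i s → lookup (Q i) s ≡ lookup (P (φ i)) (π s)) →
    ∀ {y x} → (∀ s → lookup x s ≡ lookup y (π s)) → InAff P B y → InAff Q (λ _ → ⊤) x
  InAff-pullback {M = M} {Q = Q} {B} B? φ φ-injective φ-onto π Q≡ {y} {x} x≡ (λs , support , total , coords) =
    λs′ , (λ i ¬⊤ → ⊥-elim (¬⊤ tt)) , total′ , coords′
    where
    open ≡-Reasoning
    λs′ : Vec ℚ M
    λs′ = Vec.tabulate (lookup λs ∘ φ)
    reindex : (g : Fin N → ℚ) → (∀ j → ¬ B j → g j ≡ 0ℚ) → sum (g ∘ φ) ≡ sum g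
    reindex = sum-reindex B? φ φ-injective φ-onto
    total′ : sumℚ λs′ ≡ 1ℚ
    total′ = begin
      sumℚ λs′             ≡⟨ sumℚ-lookup λs′ ⟩
      sum (lookup λs′)     ≡⟨ sum-cong-≗ (Vecₚ.lookup∘tabulate (lookup λs ∘ φ)) ⟩
      sum (lookup λs ∘ φ)  ≡⟨ reindex (lookup λs) support ⟩
      sum (lookup λs)      ≡⟨ sumℚ-lookup λs ⟨
      sumℚ λs              ≡⟨ total ⟩
      1ℚ                   ∎
    coords′ : ∀ s → Vec.foldr′ ℚ._+_ 0ℚ (Vec.tabulate (λ i → lookup λs′ i ℚ.* toℚ (lookup (Q i) s)))
                    ≡ toℚ (lookup x s)
    coords′ s = begin
      Vec.foldr′ ℚ._+_ 0ℚ (Vec.tabulate (λ i → lookup λs′ i ℚ.* toℚ (lookup (Q i) s)))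
        ≡⟨ foldr-tabulate (λ i → lookup λs′ i ℚ.* toℚ (lookup (Q i) s)) ⟩
      sum (λ i → lookup λs′ i ℚ.* toℚ (lookup (Q i) s))
        ≡⟨ sum-cong-≗ (λ i → cong₂ (λ l q → l ℚ.* toℚ q) (Vecₚ.lookup∘tabulate _ i) (Q≡ i s)) ⟩
      sum (weighted ∘ φ)
        ≡⟨ reindex weighted (λ j ¬Bj → trans (cong (ℚ._* _) (support j ¬Bj))
                                             (ℚₚ.*-zeroˡ (toℚ (lookup (P j) (π s))))) ⟩
      sum weighted
        ≡⟨ foldr-tabulate weighted ⟨
      Vec.foldr′ ℚ._+_ 0ℚ (Vec.tabulate weighted)
        ≡⟨ coords (π s) ⟩
      toℚ (lookup y (π s))
        ≡⟨ cong toℚ (x≡ s) ⟨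
      toℚ (lookup x s) ∎
      where
      weighted : Fin N → ℚ
      weighted j = lookup λs j ℚ.* toℚ (lookup (P j) (π s))

LatticeIsomorphic-cong : ∀ {m M n N} {Q : Fin M → Pt m} {P : Fin N → Pt n} {B B′ : Fin N → Set} →
  (∀ i → B i → B′ i) → (∀ i → B′ i → B i) → LatticeIsomorphic Q P B → LatticeIsomorphic Q P B′
LatticeIsomorphic-cong {P = P} B⇒B′ B′⇒B (A , b , into , onto , injective , hull) =
  A , b , (λ q → let i , Bi , eq = into q in i , B⇒B′ i Bi , eq) , (λ i → onto i ∘ B′⇒B i) ,
  injective , (λ y → hull y ∘ InAff-mono {P = P} {y = y} B′⇒B)

zerosℤ : ∀ m → Vec ℤ m
zerosℤ m = replicate m (ℤ.+ 0)

dotℤ-zeros : ∀ {m} (x : Pt m) → dotℤ (zerosℤ m) x ≡ ℤ.+ 0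
dotℤ-zeros []      = refl
dotℤ-zeros (t ∷ x) = trans (ℤₚ.+-identityˡ (dotℤ (zerosℤ _) x)) (dotℤ-zeros x)

dotℤ-unit : ∀ {m} (s : Fin m) c (x : Pt m) → dotℤ (zerosℤ m [ s ]≔ c) x ≡ c ℤ.* lookup x s
dotℤ-unit zero    c (t ∷ x) = trans (cong (ℤ._+_ (c ℤ.* t)) (dotℤ-zeros x)) (ℤₚ.+-identityʳ (c ℤ.* t))
dotℤ-unit (suc s) c (t ∷ x) = trans (ℤₚ.+-identityˡ _) (dotℤ-unit s c x)

identityMatrix : ∀ m → Vec (Vec ℤ m) m
identityMatrix m = Vec.tabulate (λ s → zerosℤ m [ s ]≔ ℤ.+ 1)

affMap-identity : ∀ {m} (x : Pt m) → affMap (identityMatrix m) (zerosℤ m) x ≡ x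
affMap-identity {m} x = Pointwise-≡⇒≡ (ext λ s → begin
  lookup (affMap (identityMatrix m) (zerosℤ m) x) s
    ≡⟨ Vecₚ.lookup-zipWith _ s (identityMatrix m) (zerosℤ m) ⟩
  dotℤ (lookup (identityMatrix m) s) x ℤ.+ lookup (zerosℤ m) s
    ≡⟨ cong₂ (λ row z → dotℤ row x ℤ.+ z) (Vecₚ.lookup∘tabulate _ s) (Vecₚ.lookup-replicate s (ℤ.+ 0)) ⟩
  dotℤ (zerosℤ m [ s ]≔ ℤ.+ 1) x ℤ.+ ℤ.+ 0
    ≡⟨ ℤₚ.+-identityʳ _ ⟩
  dotℤ (zerosℤ m [ s ]≔ ℤ.+ 1) x
    ≡⟨ dotℤ-unit s (ℤ.+ 1) x ⟩
  ℤ.+ 1 ℤ.* lookup x s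
    ≡⟨ ℤₚ.*-identityˡ (lookup x s) ⟩
  lookup x s ∎)
  where open ≡-Reasoning

affMap-insertAt : ∀ {m n} (M : Vec (Vec ℤ m) n) b i r z (x : Pt m) →
                  affMap (insertAt M i r) (insertAt b i z) x ≡ insertAt (affMap M b x) i (dotℤ r x ℤ.+ z)
affMap-insertAt M         b        zero    r z x = refl
affMap-insertAt (row ∷ M) (b₀ ∷ b) (suc i) r z x = cong (dotℤ row x ℤ.+ b₀ ∷_) (affMap-insertAt M b i r z x)

-- The facet {x_i = β} of Δ(k, n+1), a copy of Δ(k − β, n)

module Facet {n k₀ k : ℕ} (i : Fin (suc n)) (β : Bool) (k≡ : ∣ β ∷ [] ∣ + k₀ ≡ k) where

  OnFacet : Fin (nV k (suc n)) → Set
  OnFacet idx = lookup (vertexVec k (suc n) idx) i ≡ β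

  OnFacet? : Decidable OnFacet
  OnFacet? idx = lookup (vertexVec k (suc n) idx) i Bool.≟ β

  ∣insertAt∣≡k : ∀ (w : Vec Bool n) → ∣ w ∣ ≡ k₀ → ∣ insertAt w i β ∣ ≡ k
  ∣insertAt∣≡k w ∣w∣ =
    trans (∣insertAt∣ w i β) (trans (∣∷∣ β w) (trans (cong (∣ β ∷ [] ∣ +_) ∣w∣) k≡))

  embedIndex : Fin (nV k₀ n) → Fin (nV k (suc n))
  embedIndex q =
    proj₁ (vertexVec-surjective (insertAt (vertexVec k₀ n q) i β) (∣insertAt∣≡k _ (∣vertexVec∣ k₀ n q)))

  vertexVec-embedIndex : ∀ q → vertexVec k (suc n) (embedIndex q) ≡ insertAt (vertexVec k₀ n q) i β
  vertexVec-embedIndex q =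
    proj₂ (vertexVec-surjective (insertAt (vertexVec k₀ n q) i β) (∣insertAt∣≡k _ (∣vertexVec∣ k₀ n q)))

  embedIndex-injective : ∀ {q q′} → embedIndex q ≡ embedIndex q′ → q ≡ q′
  embedIndex-injective {q} {q′} eq = vertexVec-injective k₀ n q q′ (begin
    vertexVec k₀ n q                                  ≡⟨ Vecₚ.removeAt-insertAt _ i β ⟨
    removeAt (insertAt (vertexVec k₀ n q) i β) i      ≡⟨ cong (λ u → removeAt u i) (vertexVec-embedIndex q) ⟨
    removeAt (vertexVec k (suc n) (embedIndex q)) i   ≡⟨ cong (λ idx → removeAt (vertexVec k (suc n) idx) i) eq ⟩
    removeAt (vertexVec k (suc n) (embedIndex q′)) i  ≡⟨ cong (λ u → removeAt u i) (vertexVec-embedIndex q′) ⟩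
    removeAt (insertAt (vertexVec k₀ n q′) i β) i     ≡⟨ Vecₚ.removeAt-insertAt _ i β ⟩
    vertexVec k₀ n q′                                 ∎)
    where open ≡-Reasoning

  embedIndex-onto : ∀ idx → OnFacet idx → ∃ λ q → embedIndex q ≡ idx
  embedIndex-onto idx on-facet = q , vertexVec-injective k (suc n) (embedIndex q) idx (begin
    vertexVec k (suc n) (embedIndex q)       ≡⟨ vertexVec-embedIndex q ⟩
    insertAt (vertexVec k₀ n q) i β          ≡⟨ cong (λ w → insertAt w i β) (proj₂ w-index) ⟩
    insertAt (removeAt u i) i β              ≡⟨ cong (insertAt (removeAt u i) i) on-facet ⟨
    insertAt (removeAt u i) i (lookup u i)   ≡⟨ Vecₚ.insertAt-removeAt u i ⟩
    u                                        ∎)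
    where
    open ≡-Reasoning
    u : Vec Bool (suc n)
    u = vertexVec k (suc n) idx
    ∣removeAt∣ : ∣ removeAt u i ∣ ≡ k₀
    ∣removeAt∣ = ℕₚ.+-cancelˡ-≡ ∣ β ∷ [] ∣ ∣ removeAt u i ∣ k₀ (begin
      ∣ β ∷ [] ∣ + ∣ removeAt u i ∣               ≡⟨ ∣∷∣ β (removeAt u i) ⟨
      ∣ β ∷ removeAt u i ∣                        ≡⟨ ∣insertAt∣ (removeAt u i) i β ⟨
      ∣ insertAt (removeAt u i) i β ∣             ≡⟨ cong (λ b → ∣ insertAt (removeAt u i) i b ∣) on-facet ⟨
      ∣ insertAt (removeAt u i) i (lookup u i) ∣  ≡⟨ cong ∣_∣ (Vecₚ.insertAt-removeAt u i) ⟩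
      ∣ u ∣                                       ≡⟨ trans (∣vertexVec∣ k (suc n) idx) (sym k≡) ⟩
      ∣ β ∷ [] ∣ + k₀                             ∎)
    w-index : ∃ λ q → vertexVec k₀ n q ≡ removeAt u i
    w-index = vertexVec-surjective (removeAt u i) ∣removeAt∣
    q : Fin (nV k₀ n)
    q = proj₁ w-index

  embedMatrix : Vec (Vec ℤ n) (suc n)
  embedMatrix = insertAt (identityMatrix n) i (zerosℤ n)

  embedOffset : Vec ℤ (suc n)
  embedOffset = insertAt (zerosℤ n) i (b2z β)

  embed : Pt n → Pt (suc n)
  embed = affMap embedMatrix embedOffset

  embed≡insertAt : ∀ x → embed x ≡ insertAt x i (b2z β)
  embed≡insertAt x = begin
    embed x
      ≡⟨ affMap-insertAt (identityMatrix n) (zerosℤ n) i (zerosℤ n) (b2z β) x ⟩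
    insertAt (affMap (identityMatrix n) (zerosℤ n) x) i (dotℤ (zerosℤ n) x ℤ.+ b2z β)
      ≡⟨ cong₂ (λ y z → insertAt y i z) (affMap-identity x)
               (trans (cong (ℤ._+ b2z β) (dotℤ-zeros x)) (ℤₚ.+-identityˡ (b2z β))) ⟩
    insertAt x i (b2z β) ∎
    where open ≡-Reasoning

  embed-vert : ∀ q → embed (vert k₀ n q) ≡ vert k (suc n) (embedIndex q)
  embed-vert q = begin
    embed (vert k₀ n q)                      ≡⟨ embed≡insertAt (vert k₀ n q) ⟩
    insertAt (vert k₀ n q) i (b2z β)         ≡⟨ Vecₚ.map-insertAt b2z β (vertexVec k₀ n q) i ⟨
    ⟦ insertAt (vertexVec k₀ n q) i β ⟧      ≡⟨ cong ⟦_⟧ (vertexVec-embedIndex q) ⟨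
    vert k (suc n) (embedIndex q)            ∎
    where open ≡-Reasoning

  embed-injective : ∀ x x′ → embed x ≡ embed x′ → x ≡ x′
  embed-injective x x′ eq = begin
    x                                    ≡⟨ Vecₚ.removeAt-insertAt x i (b2z β) ⟨
    removeAt (insertAt x i (b2z β)) i    ≡⟨ cong (λ y → removeAt y i) (embed≡insertAt x) ⟨
    removeAt (embed x) i                 ≡⟨ cong (λ y → removeAt y i) eq ⟩
    removeAt (embed x′) i                ≡⟨ cong (λ y → removeAt y i) (embed≡insertAt x′) ⟩
    removeAt (insertAt x′ i (b2z β)) i   ≡⟨ Vecₚ.removeAt-insertAt x′ i (b2z β) ⟩
    x′                                   ∎
    where open ≡-Reasoning

  facet-hull : ∀ y → InAff (vert k (suc n)) OnFacet y →
               ∃ λ x → InAff (vert k₀ n) (λ _ → ⊤) x × embed x ≡ y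
  facet-hull y y∈ =
      removeAt y i
    , InAff-pullback {P = vert k (suc n)} {Q = vert k₀ n} OnFacet? embedIndex embedIndex-injective embedIndex-onto
        (punchIn i) vert-punchIn {y = y} {x = removeAt y i} removeAt-punchIn y∈
    , (begin
      embed (removeAt y i)                   ≡⟨ embed≡insertAt (removeAt y i) ⟩
      insertAt (removeAt y i) i (b2z β)      ≡⟨ cong (insertAt (removeAt y i) i) yᵢ≡β ⟨
      insertAt (removeAt y i) i (lookup y i) ≡⟨ Vecₚ.insertAt-removeAt y i ⟩
      y                                      ∎)
    where
    open ≡-Reasoning
    yᵢ≡β : lookup y i ≡ b2z β
    yᵢ≡β = InAff-coordinate {P = vert k (suc n)} OnFacet? {y = y}
             (λ idx on-facet → trans (Vecₚ.lookup-map i b2z (vertexVec k (suc n) idx)) (cong b2z on-facet)) y∈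
    vert-punchIn : ∀ q s → lookup (vert k₀ n q) s ≡ lookup (vert k (suc n) (embedIndex q)) (punchIn i s)
    vert-punchIn q s = begin
      lookup (vert k₀ n q) s                                   ≡⟨ Vecₚ.insertAt-punchIn _ i (b2z β) s ⟨
      lookup (insertAt (vert k₀ n q) i (b2z β)) (punchIn i s)  ≡⟨ cong (λ y → lookup y (punchIn i s))
                                                                       (embed≡insertAt (vert k₀ n q)) ⟨
      lookup (embed (vert k₀ n q)) (punchIn i s)               ≡⟨ cong (λ y → lookup y (punchIn i s)) (embed-vert q) ⟩
      lookup (vert k (suc n) (embedIndex q)) (punchIn i s)     ∎
    removeAt-punchIn : ∀ s → lookup (removeAt y i) s ≡ lookup y (punchIn i s)
    removeAt-punchIn s = trans (cong (lookup (removeAt y i)) (sym (Finₚ.punchOut-punchIn i)))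
                               (Vecₚ.removeAt-punchOut y (Finₚ.punchInᵢ≢i i s ∘ sym))

  facet-isomorphic : LatticeIsomorphic (vert k₀ n) (vert k (suc n)) OnFacet
  facet-isomorphic = embedMatrix , embedOffset , into , onto , (λ x x′ _ _ → embed-injective x x′) , facet-hull
    where
    into : ∀ q → ∃ λ idx → OnFacet idx × embed (vert k₀ n q) ≡ vert k (suc n) idx
    into q = embedIndex q
           , trans (cong (λ u → lookup u i) (vertexVec-embedIndex q)) (Vecₚ.insertAt-lookup _ i β)
           , embed-vert q
    onto : ∀ idx → OnFacet idx → ∃ λ q → embed (vert k₀ n q) ≡ vert k (suc n) idx
    onto idx on-facet = let q , q↦idx = embedIndex-onto idx on-facet
                        in q , trans (embed-vert q) (cong (vert k (suc n)) q↦idx)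

  heightSlope : Bool → ℤ
  heightSlope b = if b then ℤ.-[1+ 0 ] else ℤ.+ 1

  heightRow : Vec ℤ (suc n)
  heightRow = zerosℤ (suc n) [ i ]≔ heightSlope β

  height : Vec Bool (suc n) → ℤ
  height v = dotℤ heightRow ⟦ v ⟧ ℤ.+ b2z β

  heightAt : Bool → ℤ
  heightAt b = heightSlope β ℤ.* b2z b ℤ.+ b2z β

  height≡ : ∀ v → height v ≡ heightAt (lookup v i)
  height≡ v = cong (ℤ._+ b2z β)
    (trans (dotℤ-unit i (heightSlope β) ⟦ v ⟧) (cong (heightSlope β ℤ.*_) (Vecₚ.lookup-map i b2z v)))

  height-on-facet : ∀ v → lookup v i ≡ β → height v ≡ ℤ.+ 0
  height-on-facet v vᵢ≡β = trans (height≡ v) (trans (cong heightAt vᵢ≡β) (vanishes β))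
    where
    vanishes : ∀ b → heightSlope b ℤ.* b2z b ℤ.+ b2z b ≡ ℤ.+ 0
    vanishes true  = refl
    vanishes false = refl

  height-off-facet : ∀ v → lookup v i ≡ not β → height v ≡ ℤ.+ 1
  height-off-facet v vᵢ≡¬β = trans (height≡ v) (trans (cong heightAt vᵢ≡¬β) (unit β))
    where
    unit : ∀ b → heightSlope b ℤ.* b2z (not b) ℤ.+ b2z b ≡ ℤ.+ 1
    unit true  = refl
    unit false = refl

-- Pulling Δ(k, n+1) at a vertex

subsetOf : ∀ {n} {P : Fin n → Set} → Decidable P → Subset n
subsetOf P? = Vec.tabulate (λ x → does (P? x))

module _ {n} {P : Fin n → Set} (P? : Decidable P) where

  ∈-subsetOf⁺ : ∀ {x} → P x → x ∈ subsetOf P?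
  ∈-subsetOf⁺ {x} Px = Vecₚ.lookup⇒[]= x _ (trans (Vecₚ.lookup∘tabulate _ x) (dec-true (P? x) Px))

  ∈-subsetOf⁻ : ∀ {x} → x ∈ subsetOf P? → P x
  ∈-subsetOf⁻ {x} x∈ with P? x | trans (sym (Vecₚ.lookup∘tabulate _ x)) (Vecₚ.[]=⇒lookup x∈)
  ... | yes Px | _ = Px
  ... | no _   | ()

⊈⇒∃ : ∀ {n} {p q : Subset n} → ¬ (p ⊆ q) → ∃ λ x → x ∈ p × x ∉ q
⊈⇒∃ {n} {p} {q} p⊈q
  with x , x∈p⇏x∈q ← ¬∀⟶∃¬ n (λ x → x ∈ p → x ∈ q) (λ x → (x ∈? p) →-dec (x ∈? q))
                             (λ p⊆q → p⊈q (p⊆q _)) =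
  x , decidable-stable (x ∈? p) (λ x∉p → x∈p⇏x∈q (⊥-elim ∘ x∉p)) , x∈p⇏x∈q ∘ const

agreementSlope agreementOffset : Bool → ℚ
agreementSlope  b = if b then ℚ.- 1ℚ else 1ℚ
agreementOffset b = if b then 0ℚ else ℚ.- 1ℚ

agreement : Bool → Bool → ℚ
agreement β x = agreementSlope β ℚ.* bit x ℚ.+ agreementOffset β

agreement-same : ∀ β → agreement β β ≡ ℚ.- 1ℚ
agreement-same true  = refl
agreement-same false = refl

agreement-not : ∀ β → agreement β (not β) ≡ 0ℚ
agreement-not true  = refl
agreement-not false = refl

module Pulling {k n : ℕ} (a : Fin (nV k (suc n))) where

  V : Vec Bool (suc n)
  V = vertexVec k (suc n) a

  ω : Fin (nV k (suc n)) → ℚ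
  ω idx = if does (idx Fin.≟ a) then ℚ.- 1ℚ else 0ℚ

  ω-apex : ω a ≡ ℚ.- 1ℚ
  ω-apex with a Fin.≟ a
  ... | yes _  = refl
  ... | no a≢a = ⊥-elim (a≢a refl)

  ω-other : ∀ {idx} → idx ≢ a → ω idx ≡ 0ℚ
  ω-other {idx} idx≢a with idx Fin.≟ a
  ... | yes idx≡a = ⊥-elim (idx≢a idx≡a)
  ... | no _      = refl

  ω≤0 : ∀ idx → ω idx ℚ.≤ 0ℚ
  ω≤0 idx with idx Fin.≟ a
  ... | yes _ = ℚₚ.<⇒≤ -1<0
  ... | no _  = ℚₚ.≤-refl

  Differs : Fin (suc n) → Fin (nV k (suc n)) → Set
  Differs i idx = lookup (vertexVec k (suc n) idx) i ≢ lookup V i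

  InPullCell : Fin (suc n) → Fin (nV k (suc n)) → Set
  InPullCell i idx = idx ≡ a ⊎ Differs i idx

  InPullCell? : ∀ i → Decidable (InPullCell i)
  InPullCell? i idx = (idx Fin.≟ a) ⊎-dec ¬? (lookup (vertexVec k (suc n) idx) i Bool.≟ lookup V i)

  pullCell : Fin (suc n) → Subset (nV k (suc n))
  pullCell i = subsetOf (InPullCell? i)

  apex∈pullCell : ∀ i → a ∈ pullCell i
  apex∈pullCell i = ∈-subsetOf⁺ (InPullCell? i) (inj₁ refl)

  differs⇒∈pullCell : ∀ {i idx} → Differs i idx → idx ∈ pullCell i
  differs⇒∈pullCell {i} differs = ∈-subsetOf⁺ (InPullCell? i) (inj₂ differs)

  differs⇒≢apex : ∀ {i idx} → Differs i idx → idx ≢ a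
  differs⇒≢apex differs refl = differs refl

  ∉pullCell⇔agrees : ∀ {i idx} →
                     idx ∉ pullCell i ⇔ (idx ≢ a × lookup (vertexVec k (suc n) idx) i ≡ lookup V i)
  ∉pullCell⇔agrees {i} {idx} = mk⇔
    (λ idx∉ → (λ idx≡a → idx∉ (∈-subsetOf⁺ (InPullCell? i) (inj₁ idx≡a)))
            , decidable-stable (_ Bool.≟ _) (idx∉ ∘ differs⇒∈pullCell))
    (λ (idx≢a , agrees) idx∈ → [ idx≢a , (λ differs → differs agrees) ] (∈-subsetOf⁻ (InPullCell? i) idx∈))

  pullFunctional : Fin (suc n) → Vec ℚ (suc n)
  pullFunctional i = replicate (suc n) 0ℚ [ i ]≔ agreementSlope (lookup V i)

  pullValue : Fin (suc n) → Fin (nV k (suc n)) → ℚ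
  pullValue i idx = dotℚ (pullFunctional i) (vert k (suc n) idx) ℚ.+ agreementOffset (lookup V i)

  pullValue≡ : ∀ i idx → pullValue i idx ≡ agreement (lookup V i) (lookup (vertexVec k (suc n) idx) i)
  pullValue≡ i idx = cong (ℚ._+ agreementOffset (lookup V i))
                          (dot-unit i (agreementSlope (lookup V i)) (vertexVec k (suc n) idx))

  pullCell-isCell : ∀ i → IsCell (vert k (suc n)) ω (pullCell i)
  pullCell-isCell i = isCell-intro (pullFunctional i) (agreementOffset (lookup V i)) position
    where
    agreeing : ∀ {idx} → lookup (vertexVec k (suc n) idx) i ≡ lookup V i → pullValue i idx ≡ ℚ.- 1ℚ
    agreeing {idx} agrees =
      trans (pullValue≡ i idx) (trans (cong (agreement (lookup V i)) agrees) (agreement-same (lookup V i)))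
    differing : ∀ {idx} → Differs i idx → pullValue i idx ≡ 0ℚ
    differing {idx} differs =
      trans (pullValue≡ i idx) (trans (cong (agreement (lookup V i)) (¬-not differs)) (agreement-not (lookup V i)))
    position : ∀ idx → (pullValue i idx ≡ ω idx × idx ∈ pullCell i)
                     ⊎ (pullValue i idx ℚ.< ω idx × idx ∉ pullCell i)
    position idx with idx Fin.≟ a | lookup (vertexVec k (suc n) idx) i Bool.≟ lookup V i
    ... | yes refl | _          = inj₁ (agreeing refl , apex∈pullCell i)
    ... | no idx≢a | yes agrees = inj₂ ( subst (ℚ._< 0ℚ) (sym (agreeing agrees)) -1<0
                                       , Equivalence.from ∉pullCell⇔agrees (idx≢a , agrees) )
    ... | no idx≢a | no differs = inj₁ (differing differs , differs⇒∈pullCell differs)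

  MeetsApexFacets : Subset (nV k (suc n)) → Set
  MeetsApexFacets T = ∀ j → ∃ λ idx → idx ∈ T × idx ≢ a × lookup (vertexVec k (suc n) idx) j ≡ lookup V j

  module _ {T} (T-cell : IsCell (vert k (suc n)) ω T) where

    private
      c : Vec ℚ (suc n)
      c = proj₁ T-cell

      c₀ : ℚ
      c₀ = proj₁ (proj₂ T-cell)

      below : ∀ idx → dotℚ c (vert k (suc n) idx) ℚ.+ c₀ ℚ.≤ ω idx
      below idx = proj₁ (proj₂ (proj₂ T-cell) idx)

      on-face : ∀ {idx} → idx ∈ T → idx ≢ a → dotℚ c (vert k (suc n) idx) ℚ.+ c₀ ≡ 0ℚ
      on-face {idx} idx∈T idx≢a = trans (proj₂ (proj₂ (proj₂ (proj₂ T-cell) idx)) idx∈T) (ω-other idx≢a)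

    cell-maximizer : ∀ {idx} → idx ∈ T → idx ≢ a → IsMaximizer c k (vertexVec k (suc n) idx)
    cell-maximizer {idx} idx∈T idx≢a = ∣vertexVec∣ k (suc n) idx , λ v ∣v∣ →
      let idx′ , idx′↦v = vertexVec-surjective v ∣v∣
      in +-cancelʳ-≤ c₀ (begin
        dotℚ c ⟦ v ⟧ ℚ.+ c₀                  ≡⟨ cong (λ u → dotℚ c ⟦ u ⟧ ℚ.+ c₀) idx′↦v ⟨
        dotℚ c (vert k (suc n) idx′) ℚ.+ c₀  ≤⟨ below idx′ ⟩
        ω idx′                               ≤⟨ ω≤0 idx′ ⟩
        0ℚ                                   ≡⟨ on-face idx∈T idx≢a ⟨
        dotℚ c (vert k (suc n) idx) ℚ.+ c₀   ∎)
      where open ℚₚ.≤-Reasoning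

    apex-below : ∀ {idx} → idx ∈ T → idx ≢ a → dotℚ c ⟦ V ⟧ ℚ.< dotℚ c (vert k (suc n) idx)
    apex-below {idx} idx∈T idx≢a = +-cancelʳ-< c₀ (begin-strict
      dotℚ c ⟦ V ⟧ ℚ.+ c₀                 ≤⟨ below a ⟩
      ω a                                 ≡⟨ ω-apex ⟩
      ℚ.- 1ℚ                              <⟨ -1<0 ⟩
      0ℚ                                  ≡⟨ on-face idx∈T idx≢a ⟨
      dotℚ c (vert k (suc n) idx) ℚ.+ c₀  ∎)
      where open ℚₚ.≤-Reasoning

    cell-misses-apex-facet : ¬ MeetsApexFacets T
    cell-misses-apex-facet meets with idx , idx∈T , idx≢a , _ ← meets zero =
      ℚₚ.<-irrefl refl
        (ℚₚ.<-≤-trans (apex-below idx∈T idx≢a) (proj₂ V-max _ (∣vertexVec∣ k (suc n) idx)))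
      where
      V-max : IsMaximizer c k V
      V-max = agreeing-maximizer {c = c} V (∣vertexVec∣ k (suc n) a) λ j →
        let idx , idx∈T , idx≢a , agrees = meets j
        in vertexVec k (suc n) idx , cell-maximizer idx∈T idx≢a , agrees

  pullCell-complete : ∀ S → IsMaximalCell (vert k (suc n)) ω S → ∃ λ i → pullCell i ≡ S
  pullCell-complete S (S-cell , S-max) with any? (λ i → S ⊆? pullCell i)
  ... | yes (i , S⊆) = i , S-max (pullCell i) (pullCell-isCell i) S⊆
  ... | no ∄i = ⊥-elim (cell-misses-apex-facet S-cell λ j →
    let idx , idx∈S , idx∉ = ⊈⇒∃ (λ S⊆ → ∄i (j , S⊆))
    in idx , idx∈S , Equivalence.to ∉pullCell⇔agrees idx∉)

  module _ (2≤k : 2 ≤ k) (k+2≤n : k + 2 ≤ suc n) where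

    vertex-across : ∀ {i j} → i ≢ j →
                    ∃ λ idx → Differs i idx × lookup (vertexVec k (suc n) idx) j ≡ lookup V j
    vertex-across {i} {j} i≢j =
      let w , ∣w∣ , wᵢ , wⱼ = vertex-with-values i j i≢j 2≤k k+2≤n (not (lookup V i)) (lookup V j)
          idx , idx↦w      = vertexVec-surjective w ∣w∣
      in idx , (λ agrees → not-¬ refl (trans (sym agrees) (trans (cong (λ u → lookup u i) idx↦w) wᵢ)))
             , trans (cong (λ u → lookup u j) idx↦w) wⱼ

    pullCell-maximal : ∀ i → IsMaximalCell (vert k (suc n)) ω (pullCell i)
    pullCell-maximal i = pullCell-isCell i , λ T T-cell cell⊆T → ⊆-antisym (T⊆cell T-cell cell⊆T) cell⊆T
      where
      T⊆cell : ∀ {T} → IsCell (vert k (suc n)) ω T → pullCell i ⊆ T → T ⊆ pullCell i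
      T⊆cell {T} T-cell cell⊆T {idx} idx∈T with idx ∈? pullCell i
      ... | yes idx∈cell = idx∈cell
      ... | no  idx∉cell = ⊥-elim (cell-misses-apex-facet T-cell meets)
        where
        meets : MeetsApexFacets T
        meets j with j Fin.≟ i
        ... | yes refl = idx , idx∈T , Equivalence.to ∉pullCell⇔agrees idx∉cell
        ... | no j≢i   = let idx′ , differs , agrees = vertex-across (j≢i ∘ sym)
                         in idx′ , cell⊆T (differs⇒∈pullCell differs) , differs⇒≢apex differs , agrees

    pullCell-injective : ∀ i i′ → pullCell i ≡ pullCell i′ → i ≡ i′
    pullCell-injective i i′ same with i Fin.≟ i′
    ... | yes i≡i′ = i≡i′
    ... | no i≢i′ with idx , differs , agrees ← vertex-across i≢i′ =
      ⊥-elim (Equivalence.from ∉pullCell⇔agrees (differs⇒≢apex differs , agrees)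
                (subst (idx ∈_) same (differs⇒∈pullCell differs)))

  pullCell-pyramid : ∀ i {k₀} → ∣ not (lookup V i) ∷ [] ∣ + k₀ ≡ k →
                     IsPyramidHeightOneOver (vert k₀ n) (vert k (suc n)) (pullCell i)
  pullCell-pyramid i k≡ =
    a , apex∈pullCell i , LatticeIsomorphic-cong facet⇒base base⇒facet facet-isomorphic ,
    heightRow , b2z (not (lookup V i)) ,
    (λ idx idx∈ idx≢a → height-on-facet (vertexVec k (suc n) idx) (base⇒facet idx (idx∈ , idx≢a))) ,
    height-off-facet V (sym (not-involutive (lookup V i)))
    where
    open Facet i (not (lookup V i)) k≡
    facet⇒base : ∀ idx → OnFacet idx → idx ∈ pullCell i × idx ≢ a
    facet⇒base idx on-facet = differs⇒∈pullCell differs , differs⇒≢apex differs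
      where
      differs : Differs i idx
      differs agrees = not-¬ refl (trans (sym agrees) on-facet)
    base⇒facet : ∀ idx → idx ∈ pullCell i × idx ≢ a → OnFacet idx
    base⇒facet idx (idx∈ , idx≢a) = [ ⊥-elim ∘ idx≢a , ¬-not ] (∈-subsetOf⁻ (InPullCell? i) idx∈)

n<ᵇn : ∀ n → (n <ᵇ n) ≡ false
n<ᵇn zero    = refl
n<ᵇn (suc n) = n<ᵇn n

<ᵇ-true : ∀ {m n} → m < n → (m <ᵇ n) ≡ true
<ᵇ-true m<n = Equivalence.to T-≡ (ℕₚ.<⇒<ᵇ m<n)

<ᵇ-false : ∀ {m n} → n ≤ m → (m <ᵇ n) ≡ false
<ᵇ-false {m} {n} n≤m = ¬-not (λ m<ᵇn → ℕₚ.<⇒≱ (ℕₚ.<ᵇ⇒< m n (Equivalence.from T-≡ m<ᵇn)) n≤m)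

punchOut-<ᵇ : ∀ {n} {i j : Fin (suc n)} (i≢j : i ≢ j) →
              (toℕ (punchOut i≢j) <ᵇ toℕ i) ≡ (toℕ j <ᵇ toℕ i)
punchOut-<ᵇ {_}     {zero}  {zero}  i≢j = ⊥-elim (i≢j refl)
punchOut-<ᵇ {_}     {zero}  {suc j} _   = refl
punchOut-<ᵇ {suc n} {suc i} {zero}  _   = refl
punchOut-<ᵇ {suc n} {suc i} {suc j} i≢j = punchOut-<ᵇ (i≢j ∘ cong suc)

ones-first : ∀ {n} (V : Vec Bool n) →
             Σ (Permutation′ n) λ π → ∀ j → lookup V (π ⟨$⟩ʳ j) ≡ (toℕ j <ᵇ ∣ V ∣)
ones-first []          = Perm.id , λ ()
ones-first (true ∷ V)  with π , sorted ← ones-first V = Perm.lift₀ π , λ { zero → refl ; (suc j) → sorted j }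
ones-first {suc n} (false ∷ V) with π , sorted ← ones-first V = Perm.insert p zero π , sorted′
  where
  -- the leading zero is listed right after the ∣ V ∣ ones
  p : Fin (suc n)
  p = Fin.fromℕ< (s≤s (∣p∣≤n V))
  toℕp≡∣V∣ : toℕ p ≡ ∣ V ∣
  toℕp≡∣V∣ = Finₚ.toℕ-fromℕ< (s≤s (∣p∣≤n V))
  sorted′ : ∀ j → lookup (false ∷ V) (Perm.insert p zero π ⟨$⟩ʳ j) ≡ (toℕ j <ᵇ ∣ V ∣)
  sorted′ j with p Fin.≟ j
  ... | yes refl = sym (trans (cong (toℕ p <ᵇ_) (sym toℕp≡∣V∣)) (n<ᵇn (toℕ p)))
  ... | no p≢j   = trans (sorted (punchOut p≢j))
                     (subst (λ m → (toℕ (punchOut p≢j) <ᵇ m) ≡ (toℕ j <ᵇ m)) toℕp≡∣V∣ (punchOut-<ᵇ p≢j))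

-- κ as a pulling

module KappaAsPulling (k n : ℕ) (k≤n : k ≤ n) where

  last : ℕ
  last = nV k n ∸ 1

  suc-last : suc last ≡ nV k n
  suc-last = ℕₚ.m+[n∸m]≡n nonempty
    where
    nonempty : 1 ≤ nV k n
    nonempty = let w , ∣w∣ = vertex-of-size k≤n
               in ℕₚ.≤-<-trans z≤n (Finₚ.toℕ<n (proj₁ (vertexVec-surjective w ∣w∣)))

  apex : Fin (nV (suc k) (suc n))
  apex = Fin.fromℕ< (subst₂ _≤_ (sym suc-last) (sym (nV-suc k n)) (ℕₚ.m≤m+n (nV k n) (nV (suc k) n)))

  toℕ-apex : toℕ apex ≡ last
  toℕ-apex = Finₚ.toℕ-fromℕ< _

  open Pulling {suc k} {n} apex using (ω; ω-apex; ω-other)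

  e₀ : Vec ℚ (suc n)
  e₀ = replicate (suc n) 0ℚ [ zero ]≔ 1ℚ

  κ≡ω+x₀ : ∀ idx → κ (suc k) (suc n) idx ≡ ω idx ℚ.+ dotℚ e₀ (vert (suc k) (suc n) idx)
  κ≡ω+x₀ idx = begin
    κ (suc k) (suc n) idx
                          ≡⟨ cong (λ t → if toℕ idx <ᵇ t ∸ 1 then 1ℚ else 0ℚ) (nV≡C k n) ⟨
    (if toℕ idx <ᵇ last then 1ℚ else 0ℚ)          ≡⟨ by-position (ℕₚ.<-cmp (toℕ idx) last) ⟩
    ω idx ℚ.+ bit (toℕ idx <ᵇ nV k n)             ≡⟨ cong (λ b → ω idx ℚ.+ bit b) (vertexVec-first k n idx) ⟨
    ω idx ℚ.+ bit (lookup (vertexVec (suc k) (suc n) idx) zero)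
                                                  ≡⟨ cong (ω idx ℚ.+_) first-coordinate ⟨
    ω idx ℚ.+ dotℚ e₀ (vert (suc k) (suc n) idx)  ∎
    where
    open ≡-Reasoning
    first-coordinate : dotℚ e₀ (vert (suc k) (suc n) idx) ≡ bit (lookup (vertexVec (suc k) (suc n) idx) zero)
    first-coordinate = trans (dot-unit zero 1ℚ (vertexVec (suc k) (suc n) idx)) (ℚₚ.*-identityˡ _)
    ≢apex : toℕ idx ≢ last → idx ≢ apex
    ≢apex ≢last idx≡apex = ≢last (trans (cong toℕ idx≡apex) toℕ-apex)
    by-position : Tri (toℕ idx < last) (toℕ idx ≡ last) (last < toℕ idx) →
                  (if toℕ idx <ᵇ last then 1ℚ else 0ℚ) ≡ ω idx ℚ.+ bit (toℕ idx <ᵇ nV k n)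
    by-position (tri< idx<last idx≢last _)
      rewrite <ᵇ-true idx<last | ω-other (≢apex idx≢last)
            | <ᵇ-true (subst (toℕ idx <_) suc-last (ℕₚ.m<n⇒m<1+n idx<last)) = refl
    by-position (tri≈ _ idx≡last _)
      rewrite idx≡last | n<ᵇn last
            | Finₚ.toℕ-injective {i = idx} {j = apex} (trans idx≡last (sym toℕ-apex)) | ω-apex
            | <ᵇ-true (subst (last <_) suc-last (ℕₚ.n<1+n last)) = refl
    by-position (tri> _ idx≢last last<idx)
      rewrite <ᵇ-false (ℕₚ.<⇒≤ last<idx) | ω-other (≢apex idx≢last)
            | <ᵇ-false (subst (_≤ toℕ idx) suc-last last<idx) = refl

proposition4p9 : (k n : ℕ) → 2 ≤ k → k + 2 ≤ n →
    Σ (Fin n → Subset (nV k n)) λ cells →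
      (∀ j j' → cells j ≡ cells j' → j ≡ j')
      × (∀ j → IsMaximalCell (vert k n) (κ k n) (cells j))
      × (∀ S → IsMaximalCell (vert k n) (κ k n) S → ∃ λ j → cells j ≡ S)
      × (∀ j → toℕ j < k → IsPyramidHeightOneOver (vert k (n ∸ 1)) (vert k n) (cells j))
      × (∀ j → k ≤ toℕ j → IsPyramidHeightOneOver (vert (k ∸ 1) (n ∸ 1)) (vert k n) (cells j))
proposition4p9 (suc k) (suc n) 2≤k k+2≤n =
    (λ j → pullCell (σ j))
  , (λ j j′ → σ-injective ∘ pullCell-injective 2≤k k+2≤n (σ j) (σ j′))
  , (λ j → Equivalence.to κ⇔ω (pullCell-maximal 2≤k k+2≤n (σ j)))
  , (λ S S-max → let i , i↦S = pullCell-complete S (Equivalence.from κ⇔ω S-max)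
                 in π ⟨$⟩ˡ i , trans (cong pullCell (Perm.inverseʳ π)) i↦S)
  , (λ j j<k → pullCell-pyramid (σ j) (cong (λ b → ∣ not b ∷ [] ∣ + suc k) (trans (σ-sorted j) (<ᵇ-true j<k))))
  , (λ j k≤j → pullCell-pyramid (σ j) (cong (λ b → ∣ not b ∷ [] ∣ + k) (trans (σ-sorted j) (<ᵇ-false k≤j))))
  where
  open KappaAsPulling k n (ℕₚ.≤-pred (ℕₚ.m+n≤o⇒m≤o (suc k) k+2≤n))
  open Pulling {suc k} {n} apex
  κ⇔ω : ∀ {S} → IsMaximalCell (vert (suc k) (suc n)) ω S
               ⇔ IsMaximalCell (vert (suc k) (suc n)) (κ (suc k) (suc n)) S
  κ⇔ω = IsMaximalCell-shift e₀ κ≡ω+x₀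
  π : Permutation′ (suc n)
  π = proj₁ (ones-first V)
  σ : Fin (suc n) → Fin (suc n)
  σ = π ⟨$⟩ʳ_
  σ-injective : ∀ {j j′} → σ j ≡ σ j′ → j ≡ j′
  σ-injective eq = trans (sym (Perm.inverseˡ π)) (trans (cong (π ⟨$⟩ˡ_) eq) (Perm.inverseˡ π))
  σ-sorted : ∀ j → lookup V (σ j) ≡ (toℕ j <ᵇ suc k)
  σ-sorted j = trans (proj₂ (ones-first V) j) (cong (toℕ j <ᵇ_) (∣vertexVec∣ (suc k) (suc n) apex))
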